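{- Let $\{G_n^*(x)\}$ be a generalized Fibonacci polynomial sequence of Lucas type, and let $m,n$ be positive integers. If $m\mid n$ and $E_2(n)=E_2(m)$, then $\gcd(G_n^*(x),G_m^*(x))=G_m^*(x)$.
   Context: All polynomials lie in $\mathbb{Z}[x]$ and $\gcd$ denotes the greatest common divisor in $\mathbb{Z}[x]$ (determined up to sign). A generalized Fibonacci polynomial (GFP) sequence $\{G_n(x)\}_{n\ge0}$ is given by $G_0(x)=p_0(x)$, $G_1(x)=p_1(x)$ and $G_n(x)=d(x)G_{n-1}(x)+g(x)G_{n-2}(x)$ for $n\ge 2$, where $p_0(x)$ is a constant and $p_1(x),d(x),g(x)$ are nonzero polynomials in $\mathbb{Z}[x]$ with $\gcd(d(x),g(x))=1$; as in the paper it is assumed that $d(x)^2+4g(x)>0$. Let $a,b$ be the roots of $z^2-d(x)z-g(x)=0$. The sequence is of Lucas type if $p_0\ne 0$, $2p_1(x)=p_0\,d(x)$, $|p_0|\in\{1,2\}$, and $\gcd(p_0,p_1(x))=\gcd(p_0,d(x))=\gcd(p_0,g(x))=1$; then, with $\alpha=2/p_0$, $G_n=(a^n+b^n)/\alpha$ (denoted $G_n^*$). For a positive integer $n$, $E_2(n)$ is the largest integer $k$ with $2^k\mid n$. -}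

module Defs where

open import Data.Nat as ℕ using (ℕ; zero; suc)
open import Data.Integer as ℤ using (ℤ; +_; ∣_∣)
open import Data.Rational as ℚ using (ℚ; 0ℚ)
open import Data.List using (List; []; _∷_)
open import Data.Product using (Σ; _×_)
open import Data.Nat.Divisibility using () renaming (_∣_ to _∣ℕ_)
open import Relation.Binary.PropositionalEquality using (_≡_)

-- Polynomials in ℤ[x]: coefficient lists, constant term first.
Poly : Set
Poly = List ℤ

coeff : Poly → ℕ → ℤ
coeff []      _       = + 0
coeff (a ∷ p) zero    = a
coeff (a ∷ p) (suc k) = coeff p k

-- equality of polynomials (coefficientwise; trailing zeros irrelevant)
infix 4 _≈_
_≈_ : Poly → Poly → Set
p ≈ q = ∀ k → coeff p k ≡ coeff q k

const : ℤ → Poly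
const c = c ∷ []

infixl 6 _⊕_
_⊕_ : Poly → Poly → Poly
[]      ⊕ q       = q
(a ∷ p) ⊕ []      = a ∷ p
(a ∷ p) ⊕ (b ∷ q) = (a ℤ.+ b) ∷ (p ⊕ q)

scale : ℤ → Poly → Poly
scale c []      = []
scale c (a ∷ p) = (c ℤ.* a) ∷ scale c p

infixl 7 _⊛_
_⊛_ : Poly → Poly → Poly
[]      ⊛ q = []
(a ∷ p) ⊛ q = scale a q ⊕ (+ 0 ∷ (p ⊛ q))

infix 4 _∣ₚ_
_∣ₚ_ : Poly → Poly → Set
p ∣ₚ q = Σ Poly (λ r → q ≈ p ⊛ r)

-- D is a greatest common divisor of P and Q in ℤ[x] (gcd is determined up to sign)
IsGCD : Poly → Poly → Poly → Set
IsGCD P Q D = (D ∣ₚ P) × (D ∣ₚ Q) × (∀ E → E ∣ₚ P → E ∣ₚ Q → E ∣ₚ D)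

evalℚ : Poly → ℚ → ℚ
evalℚ []      q = 0ℚ
evalℚ (a ∷ p) q = (a ℚ./ 1) ℚ.+ q ℚ.* evalℚ p q

GFP : ℤ → Poly → Poly → Poly → ℕ → Poly
GFP p₀ p₁ d g zero          = const p₀
GFP p₀ p₁ d g (suc zero)    = p₁
GFP p₀ p₁ d g (suc (suc n)) = d ⊛ GFP p₀ p₁ d g (suc n) ⊕ g ⊛ GFP p₀ p₁ d g n

IsE₂ : ℕ → ℕ → Set
IsE₂ n k = (2 ℕ.^ k ∣ℕ n) × (∀ j → 2 ℕ.^ j ∣ℕ n → j ℕ.≤ k)

{-# OPTIONS --safe #-}
-- Put α = 2 / p₀, an integer since ∣ p₀ ∣ ≤ 2. Then V = α G is the companion Lucas
-- sequence a ^ k + b ^ k, which satisfies the same recurrence with V 0 = 2 and V 1 = d.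
-- Every sequence H obeying the recurrence satisfies
--   H (2 m + n) + (- g) ^ m H n = V m H (m + n),
-- so with H = G and n = t m, G ((t + 2) m) ≡ - (- g) ^ m G (t m) modulo V m = α G m.
-- Hence G m divides G (t m) for every odd t, and E₂ n = E₂ m says exactly that n / m is odd.
module Submission where

open import Data.Nat as ℕ using (ℕ; zero; suc; parity)
open import Data.Parity.Base using (0ℙ; 1ℙ)
open import Data.Product using (Σ; _×_; _,_)
open import Data.Nat.Divisibility using (divides; *-pres-∣; ∣m∣n⇒∣m+n; ∣-refl) renaming (_∣_ to _∣ℕ_)
open import Algebra using (CommutativeRing; Semiring)
open import Relation.Binary.PropositionalEquality as ≡ using (_≡_; module ≡-Reasoning)
open import Relation.Nullary using (contradiction)
import Data.Nat.Properties as ℕ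

double : ℕ → ℕ
double zero    = zero
double (suc m) = suc (suc (double m))

double-+ : ∀ m n → double m ℕ.+ n ≡ m ℕ.+ (m ℕ.+ n)
double-+ zero    n = ≡.refl
double-+ (suc m) n = ≡.cong suc (begin
  suc (double m ℕ.+ n)   ≡⟨ ≡.cong suc (double-+ m n) ⟩
  suc (m ℕ.+ (m ℕ.+ n))  ≡⟨ ℕ.+-suc m (m ℕ.+ n) ⟨
  m ℕ.+ suc (m ℕ.+ n)    ∎)
  where open ≡-Reasoning

parity≡0ℙ⇒2∣ : ∀ t → parity t ≡ 0ℙ → 2 ∣ℕ t
parity≡0ℙ⇒2∣ zero          _    = divides 0 ≡.refl
parity≡0ℙ⇒2∣ (suc (suc t)) even = ∣m∣n⇒∣m+n (∣-refl {2}) (parity≡0ℙ⇒2∣ t even)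

module LinearRecurrence {c ℓ} (R : CommutativeRing c ℓ) (d g : CommutativeRing.Carrier R) where

  open CommutativeRing R
  open import Algebra.Definitions.RawSemiring (Semiring.rawSemiring semiring) using (_^_)
  open import Algebra.Properties.Ring ring using (-‿distribˡ-*; -‿distribʳ-*; [y-z]x≈yx-zx)
  open import Algebra.Properties.Group +-group using (⁻¹-involutive; //-rightDividesʳ)
  open import Algebra.Properties.Semiring.Divisibility semiring
    using (_∣_; _,_; ∣ʳ-reflexive; ∣ʳ-respʳ-≈; x∣ʳyx; x∣ʳy⇒x∣ʳzy)
  open import Algebra.Solver.Ring.NaturalCoefficients.Default commutativeSemiring
  open import Relation.Binary.Reasoning.Setoid setoid

  Recurrent : (ℕ → Carrier) → Set ℓ
  Recurrent H = ∀ n → H (suc (suc n)) ≈ d * H (suc n) + g * H n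

  Recurrent-*ˡ : ∀ κ {H} → Recurrent H → Recurrent (λ n → κ * H n)
  Recurrent-*ˡ κ {H} H-rec n = begin
    κ * H (suc (suc n))                  ≈⟨ *-congˡ (H-rec n) ⟩
    κ * (d * H (suc n) + g * H n)        ≈⟨ solve 5 (λ κ d g a b → κ :* (d :* a :+ g :* b) := d :* (κ :* a) :+ g :* (κ :* b))
                                                    refl κ d g (H (suc n)) (H n) ⟩
    d * (κ * H (suc n)) + g * (κ * H n)  ∎

  -x*y+x*y≈0 : ∀ x y → (- x) * y + x * y ≈ 0#
  -x*y+x*y≈0 x y = begin
    (- x) * y + x * y  ≈⟨ distribʳ y (- x) x ⟨
    (- x + x) * y      ≈⟨ *-congʳ (-‿inverseˡ x) ⟩
    0# * y             ≈⟨ zeroˡ y ⟩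
    0#                 ∎

  -x*[-x*y]≈x*[x*y] : ∀ x y → (- x) * ((- x) * y) ≈ x * (x * y)
  -x*[-x*y]≈x*[x*y] x y = begin
    (- x) * ((- x) * y)  ≈⟨ -‿distribˡ-* x ((- x) * y) ⟨
    - (x * ((- x) * y))  ≈⟨ -‿cong (*-congˡ (-‿distribˡ-* x y)) ⟨
    - (x * - (x * y))    ≈⟨ -‿cong (-‿distribʳ-* x (x * y)) ⟨
    - - (x * (x * y))    ≈⟨ ⁻¹-involutive (x * (x * y)) ⟩
    x * (x * y)          ∎

  ∣x+y∧∣y⇒∣x : ∀ {a x y} → a ∣ x + y → a ∣ y → a ∣ x
  ∣x+y∧∣y⇒∣x {a} {x} {y} (q , qa≈x+y) (s , sa≈y) = q - s , (begin
    (q - s) * a    ≈⟨ [y-z]x≈yx-zx a q s ⟩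
    q * a - s * a  ≈⟨ +-cong qa≈x+y (-‿cong sa≈y) ⟩
    x + y - y      ≈⟨ //-rightDividesʳ y x ⟩
    x              ∎)

  -- The inductive step of doubling-identity. The solver only handles commutative semirings,
  -- so - g is passed as a separate variable after applying the two laws it needs.
  recurrence-step : ∀ x₃ x₂ p h₁ h₀ →
    d * x₃ + g * x₂ + (- g) * ((- g) * p) * h₀ ≈
    d * (x₃ + (- g) * p * h₁) + g * (x₂ + p * (d * h₁ + g * h₀))
  recurrence-step x₃ x₂ p h₁ h₀ = begin
    d * x₃ + g * x₂ + (- g) * ((- g) * p) * h₀
      ≈⟨ +-congˡ (*-congʳ (-x*[-x*y]≈x*[x*y] g p)) ⟩
    d * x₃ + g * x₂ + g * (g * p) * h₀
      ≈⟨ +-identityʳ _ ⟨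
    d * x₃ + g * x₂ + g * (g * p) * h₀ + 0#
      ≈⟨ +-congˡ (-x*y+x*y≈0 g (d * p * h₁)) ⟨
    d * x₃ + g * x₂ + g * (g * p) * h₀ + ((- g) * (d * p * h₁) + g * (d * p * h₁))
      ≈⟨ solve 8 (λ d g -g x₃ x₂ p h₁ h₀ →
                  d :* x₃ :+ g :* x₂ :+ g :* (g :* p) :* h₀ :+ (-g :* (d :* p :* h₁) :+ g :* (d :* p :* h₁)) :=
                  d :* (x₃ :+ -g :* p :* h₁) :+ g :* (x₂ :+ p :* (d :* h₁ :+ g :* h₀)))
                 refl d g (- g) x₃ x₂ p h₁ h₀ ⟩
    d * (x₃ + (- g) * p * h₁) + g * (x₂ + p * (d * h₁ + g * h₀))  ∎

  module _ {V : ℕ → Carrier} (V-rec : Recurrent V) (V₀ : V 0 ≈ 1# + 1#) (V₁ : V 1 ≈ d) where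

    -- Proved for all recurrent H at once: the inductive step uses the hypothesis for
    -- the shifted sequences n ↦ H (1 + n) and n ↦ H (2 + n).
    doubling-identity : ∀ {H} → Recurrent H → ∀ m → H (double m) + (- g) ^ m * H 0 ≈ V m * H m
    doubling-identity {H} _ zero = begin
      H 0 + 1# * H 0       ≈⟨ +-congʳ (*-identityˡ (H 0)) ⟨
      1# * H 0 + 1# * H 0  ≈⟨ distribʳ (H 0) 1# 1# ⟨
      (1# + 1#) * H 0      ≈⟨ *-congʳ V₀ ⟨
      V 0 * H 0            ∎
    doubling-identity {H} H-rec (suc zero) = begin
      H 2 + (- g) * 1# * H 0             ≈⟨ +-cong (H-rec 0) (*-congʳ (*-identityʳ (- g))) ⟩
      d * H 1 + g * H 0 + (- g) * H 0    ≈⟨ +-assoc _ _ _ ⟩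
      d * H 1 + (g * H 0 + (- g) * H 0)  ≈⟨ +-congˡ (trans (+-comm _ _) (-x*y+x*y≈0 g (H 0))) ⟩
      d * H 1 + 0#                       ≈⟨ +-identityʳ _ ⟩
      d * H 1                            ≈⟨ *-congʳ V₁ ⟨
      V 1 * H 1                          ∎
    doubling-identity {H} H-rec (suc (suc m)) = begin
      H (4 ℕ.+ double m) + (- g) * ((- g) * P) * H 0
        ≈⟨ +-congʳ (H-rec _) ⟩
      d * H (3 ℕ.+ double m) + g * H (2 ℕ.+ double m) + (- g) * ((- g) * P) * H 0
        ≈⟨ recurrence-step _ _ P (H 1) (H 0) ⟩
      d * (H (3 ℕ.+ double m) + (- g) * P * H 1) + g * (H (2 ℕ.+ double m) + P * (d * H 1 + g * H 0))
        ≈⟨ +-cong (*-congˡ (doubling-identity (λ n → H-rec (suc n)) (suc m)))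
                  (*-congˡ (trans (+-congˡ (*-congˡ (sym (H-rec 0)))) (doubling-identity (λ n → H-rec (suc (suc n))) m))) ⟩
      d * (V (suc m) * H (2 ℕ.+ m)) + g * (V m * H (2 ℕ.+ m))
        ≈⟨ solve 5 (λ d g a b h → d :* (a :* h) :+ g :* (b :* h) := (d :* a :+ g :* b) :* h)
                   refl d g (V (suc m)) (V m) (H (2 ℕ.+ m)) ⟩
      (d * V (suc m) + g * V m) * H (2 ℕ.+ m)
        ≈⟨ *-congʳ (V-rec m) ⟨
      V (2 ℕ.+ m) * H (2 ℕ.+ m)  ∎
      where
      P : Carrier
      P = (- g) ^ m

    doubling-identity-+ : ∀ {H} → Recurrent H → ∀ m n →
              H (double m ℕ.+ n) + (- g) ^ m * H n ≈ V m * H (m ℕ.+ n)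
    doubling-identity-+ {H} H-rec m n = doubling-identity {λ k → H (k ℕ.+ n)} (λ k → H-rec (k ℕ.+ n)) m

  module _ {H : ℕ → Carrier} (H-rec : Recurrent H)
           (κ : Carrier) (κH₀ : κ * H 0 ≈ 1# + 1#) (κH₁ : κ * H 1 ≈ d) where

    ∣-odd-multiple : ∀ m t → parity t ≡ 1ℙ → H m ∣ H (t ℕ.* m)
    ∣-odd-multiple m 1             _   = ∣ʳ-reflexive (reflexive (≡.cong H (≡.sym (ℕ.+-identityʳ m))))
    ∣-odd-multiple m (suc (suc t)) odd =
      ∣x+y∧∣y⇒∣x (∣ʳ-respʳ-≈ (sym unfolded) (x∣ʳyx (H m) (κ * H (m ℕ.+ tm))))
                 (x∣ʳy⇒x∣ʳzy ((- g) ^ m) (∣-odd-multiple m t odd))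
      where
      tm : ℕ
      tm = t ℕ.* m
      unfolded : H (m ℕ.+ (m ℕ.+ tm)) + (- g) ^ m * H tm ≈ κ * H (m ℕ.+ tm) * H m
      unfolded = begin
        H (m ℕ.+ (m ℕ.+ tm)) + (- g) ^ m * H tm  ≈⟨ +-congʳ (reflexive (≡.cong H (double-+ m tm))) ⟨
        H (double m ℕ.+ tm) + (- g) ^ m * H tm   ≈⟨ doubling-identity-+ (Recurrent-*ˡ κ H-rec) κH₀ κH₁ H-rec m tm ⟩
        κ * H m * H (m ℕ.+ tm)                   ≈⟨ solve 3 (λ κ a b → κ :* a :* b := κ :* b :* a) refl κ (H m) (H (m ℕ.+ tm)) ⟩
        κ * H (m ℕ.+ tm) * H m                   ∎

open import Defs
open import Data.Integer as ℤ using (ℤ; +_; -[1+_]; ∣_∣)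
open import Data.Rational as ℚ using (ℚ; 0ℚ)
open import Data.Sum using (_⊎_; inj₁; inj₂)
open import Data.List using ([])
open import Relation.Binary.PropositionalEquality using (_≢_)
open import Relation.Nullary using (¬_)

-- If the quotient t were even, 2 ^ (1 + k) would divide n = t * m.
equal-E₂⇒odd-quotient : ∀ {m n k} (m∣n : m ∣ℕ n) → IsE₂ n k → IsE₂ m k →
                        parity (_∣ℕ_.quotient m∣n) ≡ 1ℙ
equal-E₂⇒odd-quotient {m} {n} {k} (divides t n≡tm) (_ , maximal) (2^k∣m , _)
  with parity t in parity-t
... | 1ℙ = ≡.refl
... | 0ℙ = contradiction (maximal (suc k) 2^[1+k]∣n) (ℕ.1+n≰n {k})
  where
  2^[1+k]∣n : 2 ℕ.^ suc k ∣ℕ n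
  2^[1+k]∣n = ≡.subst (2 ℕ.^ suc k ∣ℕ_) (≡.sym n≡tm) (*-pres-∣ (parity≡0ℙ⇒2∣ t parity-t) 2^k∣m)

module ℤ[x] where

  open import Data.Integer using (+_; _+_; _*_; -1ℤ; NonZero)
  open import Data.Integer.Properties
  open import Data.List using ([]; _∷_)
  open import Algebra using (AbelianGroup)
  open import Algebra.Structures using (IsAbelianGroup)
  open import Algebra.Consequences.Setoid using (comm∧idˡ⇒idʳ; comm∧invˡ⇒invʳ; comm∧distrʳ⇒distrˡ)
  open import Relation.Binary.Structures using (IsEquivalence)
  open import Relation.Binary.Bundles using (Setoid)
  open import Level using (0ℓ)

  coeff-⊕ : ∀ p q k → coeff (p ⊕ q) k ≡ coeff p k + coeff q k
  coeff-⊕ []      q       k       = ≡.sym (+-identityˡ (coeff q k))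
  coeff-⊕ (a ∷ p) []      k       = ≡.sym (+-identityʳ (coeff (a ∷ p) k))
  coeff-⊕ (a ∷ p) (b ∷ q) zero    = ≡.refl
  coeff-⊕ (a ∷ p) (b ∷ q) (suc k) = coeff-⊕ p q k

  coeff-scale : ∀ c p k → coeff (scale c p) k ≡ c * coeff p k
  coeff-scale c []      k       = ≡.sym (*-zeroʳ c)
  coeff-scale c (a ∷ p) zero    = ≡.refl
  coeff-scale c (a ∷ p) (suc k) = coeff-scale c p k

  -- _≈_ wrapped in a record: unlike the function type p ≈ q, the type p ≋ q
  -- determines p and q, so Agda can infer them.
  infix 4 _≋_
  record _≋_ (p q : Poly) : Set where
    field coeff-≡ : p ≈ q
  open _≋_

  ≋-refl : ∀ {p} → p ≋ p
  ≋-refl .coeff-≡ _ = ≡.refl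

  ≋-sym : ∀ {p q} → p ≋ q → q ≋ p
  ≋-sym p≋q .coeff-≡ k = ≡.sym (p≋q .coeff-≡ k)

  ≋-trans : ∀ {p q r} → p ≋ q → q ≋ r → p ≋ r
  ≋-trans p≋q q≋r .coeff-≡ k = ≡.trans (p≋q .coeff-≡ k) (q≋r .coeff-≡ k)

  ≋-isEquivalence : IsEquivalence _≋_
  ≋-isEquivalence = record { refl = ≋-refl ; sym = ≋-sym ; trans = ≋-trans }

  ≋-setoid : Setoid 0ℓ 0ℓ
  ≋-setoid = record { isEquivalence = ≋-isEquivalence }

  ∷-cong : ∀ {a b p q} → a ≡ b → p ≋ q → a ∷ p ≋ b ∷ q
  ∷-cong a≡b _   .coeff-≡ zero    = a≡b
  ∷-cong _   p≋q .coeff-≡ (suc k) = p≋q .coeff-≡ k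

  0∷[]≋[] : + 0 ∷ [] ≋ []
  0∷[]≋[] .coeff-≡ zero    = ≡.refl
  0∷[]≋[] .coeff-≡ (suc k) = ≡.refl

  ⊕-cong : ∀ {p p′ q q′} → p ≋ p′ → q ≋ q′ → p ⊕ q ≋ p′ ⊕ q′
  ⊕-cong {p} {p′} {q} {q′} p≋p′ q≋q′ .coeff-≡ k
    rewrite coeff-⊕ p q k | coeff-⊕ p′ q′ k = ≡.cong₂ _+_ (p≋p′ .coeff-≡ k) (q≋q′ .coeff-≡ k)

  ⊕-assoc : ∀ p q r → (p ⊕ q) ⊕ r ≋ p ⊕ (q ⊕ r)
  ⊕-assoc p q r .coeff-≡ k
    rewrite coeff-⊕ (p ⊕ q) r k | coeff-⊕ p q k | coeff-⊕ p (q ⊕ r) k | coeff-⊕ q r k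
    = +-assoc (coeff p k) (coeff q k) (coeff r k)

  ⊕-comm : ∀ p q → p ⊕ q ≋ q ⊕ p
  ⊕-comm p q .coeff-≡ k rewrite coeff-⊕ p q k | coeff-⊕ q p k = +-comm (coeff p k) (coeff q k)

  ⊕-identityˡ : ∀ p → [] ⊕ p ≋ p
  ⊕-identityˡ p = ≋-refl

  ⊕-identityʳ : ∀ p → p ⊕ [] ≋ p
  ⊕-identityʳ p .coeff-≡ k rewrite coeff-⊕ p [] k = +-identityʳ (coeff p k)

  ⊕-inverseˡ : ∀ p → scale -1ℤ p ⊕ p ≋ []
  ⊕-inverseˡ p .coeff-≡ k rewrite coeff-⊕ (scale -1ℤ p) p k | coeff-scale -1ℤ p k | -1*i≡-i (coeff p k)
    = +-inverseˡ (coeff p k)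

  ⊕-inverseʳ : ∀ p → p ⊕ scale -1ℤ p ≋ []
  ⊕-inverseʳ = comm∧invˡ⇒invʳ ≋-setoid ⊕-comm ⊕-inverseˡ

  scale-cong : ∀ a {p q} → p ≋ q → scale a p ≋ scale a q
  scale-cong a {p} {q} p≋q .coeff-≡ k
    rewrite coeff-scale a p k | coeff-scale a q k = ≡.cong (a *_) (p≋q .coeff-≡ k)

  scale-distribˡ : ∀ a p q → scale a (p ⊕ q) ≋ scale a p ⊕ scale a q
  scale-distribˡ a p q .coeff-≡ k
    rewrite coeff-scale a (p ⊕ q) k | coeff-⊕ p q k | coeff-⊕ (scale a p) (scale a q) k
          | coeff-scale a p k | coeff-scale a q k
    = *-distribˡ-+ a (coeff p k) (coeff q k)

  scale-distribʳ : ∀ a b p → scale (a + b) p ≋ scale a p ⊕ scale b p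
  scale-distribʳ a b p .coeff-≡ k
    rewrite coeff-scale (a + b) p k | coeff-⊕ (scale a p) (scale b p) k
          | coeff-scale a p k | coeff-scale b p k
    = *-distribʳ-+ (coeff p k) a b

  scale-scale : ∀ a b p → scale (a * b) p ≋ scale a (scale b p)
  scale-scale a b p .coeff-≡ k
    rewrite coeff-scale (a * b) p k | coeff-scale a (scale b p) k | coeff-scale b p k
    = *-assoc a b (coeff p k)

  scale-zero : ∀ p → scale (+ 0) p ≋ []
  scale-zero p .coeff-≡ = coeff-scale (+ 0) p

  scale-identity : ∀ p → scale (+ 1) p ≋ p
  scale-identity p .coeff-≡ k = ≡.trans (coeff-scale (+ 1) p k) (*-identityˡ (coeff p k))

  scale-cancel : ∀ {α β c} .{{_ : NonZero c}} {p q} →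
                 α * β ≡ c → scale c p ≈ scale β q → scale α p ≋ q
  scale-cancel {α} {β} {c} {p} {q} αβ≡c cp≈βq .coeff-≡ k =
    ≡.trans (coeff-scale α p k) (*-cancelˡ-≡ c (α * coeff p k) (coeff q k) (begin
      c * (α * coeff p k)   ≡⟨ *-assoc c α (coeff p k) ⟨
      c * α * coeff p k     ≡⟨ ≡.cong (_* coeff p k) (*-comm c α) ⟩
      α * c * coeff p k     ≡⟨ *-assoc α c (coeff p k) ⟩
      α * (c * coeff p k)   ≡⟨ ≡.cong (α *_) (≡.trans (≡.sym (coeff-scale c p k)) (≡.trans (cp≈βq k) (coeff-scale β q k))) ⟩
      α * (β * coeff q k)   ≡⟨ *-assoc α β (coeff q k) ⟨
      α * β * coeff q k     ≡⟨ ≡.cong (_* coeff q k) αβ≡c ⟩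
      c * coeff q k         ∎))
    where open ≡-Reasoning

  ⊕-isAbelianGroup : IsAbelianGroup _≋_ _⊕_ [] (scale -1ℤ)
  ⊕-isAbelianGroup = record
    { isGroup = record
      { isMonoid = record
        { isSemigroup = record
          { isMagma = record { isEquivalence = ≋-isEquivalence ; ∙-cong = ⊕-cong }
          ; assoc = ⊕-assoc
          }
        ; identity = ⊕-identityˡ , ⊕-identityʳ
        }
      ; inverse = ⊕-inverseˡ , ⊕-inverseʳ
      ; ⁻¹-cong = scale-cong -1ℤ
      }
    ; comm = ⊕-comm
    }

  ⊕-abelianGroup : AbelianGroup 0ℓ 0ℓ
  ⊕-abelianGroup = record { isAbelianGroup = ⊕-isAbelianGroup }

  open import Algebra.Properties.CommutativeSemigroup (AbelianGroup.commutativeSemigroup ⊕-abelianGroup)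
    using (x∙yz≈y∙xz; interchange)
  open import Relation.Binary.Reasoning.Setoid ≋-setoid

  ⊛-congʳ : ∀ p {q q′} → q ≋ q′ → p ⊛ q ≋ p ⊛ q′
  ⊛-congʳ []      _    = ≋-refl
  ⊛-congʳ (a ∷ p) q≋q′ = ⊕-cong (scale-cong a q≋q′) (∷-cong ≡.refl (⊛-congʳ p q≋q′))

  ⊛-zeroʳ : ∀ p → p ⊛ [] ≋ []
  ⊛-zeroʳ []      .coeff-≡ _       = ≡.refl
  ⊛-zeroʳ (a ∷ p) .coeff-≡ zero    = ≡.refl
  ⊛-zeroʳ (a ∷ p) .coeff-≡ (suc k) = ⊛-zeroʳ p .coeff-≡ k

  ⊛-∷ʳ : ∀ p a q → p ⊛ (a ∷ q) ≋ scale a p ⊕ (+ 0 ∷ p ⊛ q)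
  ⊛-∷ʳ []      a q = ≋-sym 0∷[]≋[]
  ⊛-∷ʳ (b ∷ p) a q = ∷-cong (≡.cong (_+ + 0) (*-comm b a)) (begin
    scale b q ⊕ p ⊛ (a ∷ q)                  ≈⟨ ⊕-cong ≋-refl (⊛-∷ʳ p a q) ⟩
    scale b q ⊕ (scale a p ⊕ (+ 0 ∷ p ⊛ q))  ≈⟨ x∙yz≈y∙xz (scale b q) (scale a p) (+ 0 ∷ p ⊛ q) ⟩
    scale a p ⊕ (scale b q ⊕ (+ 0 ∷ p ⊛ q))  ∎)

  ⊛-comm : ∀ p q → p ⊛ q ≋ q ⊛ p
  ⊛-comm []      q = ≋-sym (⊛-zeroʳ q)
  ⊛-comm (a ∷ p) q = begin
    scale a q ⊕ (+ 0 ∷ p ⊛ q)  ≈⟨ ⊕-cong ≋-refl (∷-cong ≡.refl (⊛-comm p q)) ⟩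
    scale a q ⊕ (+ 0 ∷ q ⊛ p)  ≈⟨ ⊛-∷ʳ q a p ⟨
    q ⊛ (a ∷ p)                ∎

  ⊛-cong : ∀ {p p′ q q′} → p ≋ p′ → q ≋ q′ → p ⊛ q ≋ p′ ⊛ q′
  ⊛-cong {p} {p′} {q} {q′} p≋p′ q≋q′ = begin
    p ⊛ q    ≈⟨ ⊛-congʳ p q≋q′ ⟩
    p ⊛ q′   ≈⟨ ⊛-comm p q′ ⟩
    q′ ⊛ p   ≈⟨ ⊛-congʳ q′ p≋p′ ⟩
    q′ ⊛ p′  ≈⟨ ⊛-comm q′ p′ ⟩
    p′ ⊛ q′  ∎

  ⊛-distribʳ : ∀ r p q → (p ⊕ q) ⊛ r ≋ p ⊛ r ⊕ q ⊛ r
  ⊛-distribʳ r []      q       = ≋-refl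
  ⊛-distribʳ r (a ∷ p) []      = ≋-sym (⊕-identityʳ ((a ∷ p) ⊛ r))
  ⊛-distribʳ r (a ∷ p) (b ∷ q) = begin
    scale (a + b) r ⊕ (+ 0 ∷ (p ⊕ q) ⊛ r)
      ≈⟨ ⊕-cong (scale-distribʳ a b r) (∷-cong ≡.refl (⊛-distribʳ r p q)) ⟩
    (scale a r ⊕ scale b r) ⊕ ((+ 0 ∷ p ⊛ r) ⊕ (+ 0 ∷ q ⊛ r))
      ≈⟨ interchange (scale a r) (scale b r) (+ 0 ∷ p ⊛ r) (+ 0 ∷ q ⊛ r) ⟩
    (scale a r ⊕ (+ 0 ∷ p ⊛ r)) ⊕ (scale b r ⊕ (+ 0 ∷ q ⊛ r))  ∎

  ⊛-distribˡ : ∀ r p q → r ⊛ (p ⊕ q) ≋ r ⊛ p ⊕ r ⊛ q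
  ⊛-distribˡ = comm∧distrʳ⇒distrˡ ≋-setoid ⊕-cong ⊛-comm ⊛-distribʳ

  scale-⊛ : ∀ a p q → scale a p ⊛ q ≋ scale a (p ⊛ q)
  scale-⊛ a []      q = ≋-refl
  scale-⊛ a (b ∷ p) q = begin
    scale (a * b) q ⊕ (+ 0 ∷ scale a p ⊛ q)
      ≈⟨ ⊕-cong (scale-scale a b q) (∷-cong (≡.sym (*-zeroʳ a)) (scale-⊛ a p q)) ⟩
    scale a (scale b q) ⊕ scale a (+ 0 ∷ p ⊛ q)
      ≈⟨ scale-distribˡ a (scale b q) (+ 0 ∷ p ⊛ q) ⟨
    scale a (scale b q ⊕ (+ 0 ∷ p ⊛ q))  ∎

  ⊛-assoc : ∀ p q r → (p ⊛ q) ⊛ r ≋ p ⊛ (q ⊛ r)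
  ⊛-assoc []      q r = ≋-refl
  ⊛-assoc (a ∷ p) q r = begin
    (scale a q ⊕ (+ 0 ∷ p ⊛ q)) ⊛ r
      ≈⟨ ⊛-distribʳ r (scale a q) (+ 0 ∷ p ⊛ q) ⟩
    scale a q ⊛ r ⊕ (scale (+ 0) r ⊕ (+ 0 ∷ (p ⊛ q) ⊛ r))
      ≈⟨ ⊕-cong (scale-⊛ a q r) (⊕-cong (scale-zero r) (∷-cong ≡.refl (⊛-assoc p q r))) ⟩
    scale a (q ⊛ r) ⊕ (+ 0 ∷ p ⊛ (q ⊛ r))  ∎

  const-⊛ : ∀ c p → const c ⊛ p ≋ scale c p
  const-⊛ c p = ≋-trans (⊕-cong ≋-refl 0∷[]≋[]) (⊕-identityʳ (scale c p))

  ⊛-identityˡ : ∀ p → const (+ 1) ⊛ p ≋ p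
  ⊛-identityˡ p = ≋-trans (const-⊛ (+ 1) p) (scale-identity p)

  ⊛-identityʳ : ∀ p → p ⊛ const (+ 1) ≋ p
  ⊛-identityʳ = comm∧idˡ⇒idʳ ≋-setoid ⊛-comm ⊛-identityˡ

  commutativeRing : CommutativeRing 0ℓ 0ℓ
  commutativeRing = record
    { isCommutativeRing = record
      { isRing = record
        { +-isAbelianGroup = ⊕-isAbelianGroup
        ; *-cong           = ⊛-cong
        ; *-assoc          = ⊛-assoc
        ; *-identity       = ⊛-identityˡ , ⊛-identityʳ
        ; distrib          = ⊛-distribˡ , ⊛-distribʳ
        }
      ; *-comm = ⊛-comm
      }
    }

  open import Algebra.Properties.Semiring.Divisibility (CommutativeRing.semiring commutativeRing)
    using (_∣_; _,_; ∣ʳ-refl)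

  ∣⇒∣ₚ : ∀ {p q} → p ∣ q → p ∣ₚ q
  ∣⇒∣ₚ {p} (r , r⊛p≋q) = r , λ k → ≡.trans (≡.sym (r⊛p≋q .coeff-≡ k)) (⊛-comm r p .coeff-≡ k)

  divisor⇒IsGCD : ∀ p q → q ∣ₚ p → IsGCD p q q
  divisor⇒IsGCD p q q∣p = q∣p , ∣⇒∣ₚ (∣ʳ-refl {q}) , λ _ _ e∣q → e∣q

open ℤ[x] using (≋-refl; ≋-trans; ∷-cong; const-⊛; scale-cancel; ∣⇒∣ₚ; divisor⇒IsGCD)

∣p∣≡1⊎2⇒p∣2 : ∀ p → ∣ p ∣ ≡ 1 ⊎ ∣ p ∣ ≡ 2 → Σ ℤ λ α → α ℤ.* p ≡ + 2
∣p∣≡1⊎2⇒p∣2 (+ .1)      (inj₁ ≡.refl) = + 2 , ≡.refl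
∣p∣≡1⊎2⇒p∣2 -[1+ 0 ]    (inj₁ ≡.refl) = -[1+ 1 ] , ≡.refl
∣p∣≡1⊎2⇒p∣2 (+ .2)      (inj₂ ≡.refl) = + 1 , ≡.refl
∣p∣≡1⊎2⇒p∣2 -[1+ 1 ]    (inj₂ ≡.refl) = -[1+ 0 ] , ≡.refl

GFP-∣-odd-multiple : ∀ p₀ p₁ d g α → α ℤ.* p₀ ≡ + 2 → scale (+ 2) p₁ ≈ scale p₀ d →
                     ∀ m t → parity t ≡ 1ℙ → GFP p₀ p₁ d g m ∣ₚ GFP p₀ p₁ d g (t ℕ.* m)
GFP-∣-odd-multiple p₀ p₁ d g α αp₀≡2 2p₁≈p₀d m t odd =
  ∣⇒∣ₚ (∣-odd-multiple {GFP p₀ p₁ d g} (λ _ → ≋-refl) (const α) αG₀ αG₁ m t odd)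
  where
  open LinearRecurrence ℤ[x].commutativeRing d g
  open ℤ[x] using (_≋_)
  αG₀ : const α ⊛ const p₀ ≋ const (+ 1) ⊕ const (+ 1)
  αG₀ = ≋-trans (const-⊛ α (const p₀)) (∷-cong αp₀≡2 ≋-refl)
  αG₁ : const α ⊛ p₁ ≋ d
  αG₁ = ≋-trans (const-⊛ α p₁) (scale-cancel αp₀≡2 2p₁≈p₀d)

proposition11 : (p₀ : ℤ) (p₁ d g : Poly) →
    ¬ (p₁ ≈ []) → ¬ (d ≈ []) → ¬ (g ≈ []) →
    IsGCD d g (const (+ 1)) →
    (∀ (q : ℚ) → 0ℚ ℚ.< evalℚ (d ⊛ d ⊕ scale (+ 4) g) q) →
    p₀ ≢ + 0 →
    scale (+ 2) p₁ ≈ scale p₀ d →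
    (∣ p₀ ∣ ≡ 1 ⊎ ∣ p₀ ∣ ≡ 2) →
    IsGCD (const p₀) p₁ (const (+ 1)) →
    IsGCD (const p₀) d (const (+ 1)) →
    IsGCD (const p₀) g (const (+ 1)) →
    (m n : ℕ) → 0 ℕ.< m → 0 ℕ.< n →
    m ∣ℕ n →
    Σ ℕ (λ k → IsE₂ n k × IsE₂ m k) →
    IsGCD (GFP p₀ p₁ d g n) (GFP p₀ p₁ d g m) (GFP p₀ p₁ d g m)
proposition11 p₀ p₁ d g _ _ _ _ _ _ 2p₁≈p₀d |p₀|≡1⊎2 _ _ _ m n _ _ m∣n@(divides t n≡tm) (_ , E₂n , E₂m) =
  divisor⇒IsGCD (G n) (G m) (≡.subst (λ i → G m ∣ₚ G i) (≡.sym n≡tm) Gm∣Gtm)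
  where
  G : ℕ → Poly
  G = GFP p₀ p₁ d g
  Gm∣Gtm : G m ∣ₚ G (t ℕ.* m)
  Gm∣Gtm = let α , αp₀≡2 = ∣p∣≡1⊎2⇒p∣2 p₀ |p₀|≡1⊎2 in
    GFP-∣-odd-multiple p₀ p₁ d g α αp₀≡2 2p₁≈p₀d m t (equal-E₂⇒odd-quotient m∣n E₂n E₂m)
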